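{- Let $n\geq0$. The map sending a partial order $\preceq$ on $[n]$ to its incidence matrix restricts to a bijection from the set of $\{\mathbf{3},\mathbf{2}+\mathbf{2}\}$-free naturally labelled posets on $[n]$ onto the set of upper-triangular $n\times n$ binary matrices $M$ with all diagonal entries equal to $1$ satisfying all of the following: (0) there are no $i<j<k$ with $M(i,j)=M(j,k)=1$; (1) there are no $a<b<c<d$ with $M(a,b)=1$, $M(a,c)=0$, $M(a,d)=0$, $M(b,c)=0$, $M(b,d)=0$, $M(c,d)=1$; (2) there are no $a<b<c<d$ with $M(a,b)=0$, $M(a,c)=1$, $M(a,d)=0$, $M(b,c)=0$, $M(b,d)=1$, $M(c,d)=0$; (3) there are no $a<b<c<d$ with $M(a,b)=0$, $M(a,c)=0$, $M(a,d)=1$, $M(b,c)=1$, $M(b,d)=0$, $M(c,d)=0$. (Equivalently, $M$ avoids the partial submatrices $M_0=\begin{pmatrix}1&\ast\\ \mathbf1&1\end{pmatrix}$, $M_1=\begin{pmatrix}1&0&0\\ \mathbf1&0&0\\ \ast&\mathbf1&1\end{pmatrix}$, $M_2=\begin{pmatrix}0&1&0\\ \mathbf1&0&1\\ \ast&\mathbf1&0\end{pmatrix}$, $M_3=\begin{pmatrix}0&0&1\\ \mathbf1&1&0\\ \ast&\mathbf1&0\end{pmatrix}$ with bold entries on the main diagonal.)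
   Context: A partial order $\preceq$ on $[n]$ is naturally labelled if $x\prec y$ implies $x<y$. It is $\mathbf{3}$-free if it has no chain $x\prec y\prec z$, and $(\mathbf{2}+\mathbf{2})$-free if it has no induced subposet isomorphic to the disjoint union of two 2-element chains (i.e. no $i\prec j$, $k\prec \ell$ with each of $i,j$ incomparable to each of $k,\ell$). The incidence matrix $M_\preceq$ has $M_\preceq(i,j)=1$ iff $i\preceq j$. -}

module Defs where

open import Data.Nat using (ℕ)
open import Data.Fin using (Fin; _<_; _>_)
open import Data.Bool using (Bool; true; false)
open import Data.Product using (_×_; ∃-syntax)
open import Relation.Nullary using (¬_; Dec; does)
open import Relation.Binary.PropositionalEquality using (_≡_; _≢_)
open import Relation.Binary using (Decidable; IsPartialOrder)

record PartialOrderOn (n : ℕ) : Set₁ where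
  field
    _≼_ : Fin n → Fin n → Set
    _≼?_ : Decidable _≼_
    isPartialOrder : IsPartialOrder _≡_ _≼_

  _≺_ : Fin n → Fin n → Set
  x ≺ y = (x ≼ y) × (x ≢ y)

  Incomparable : Fin n → Fin n → Set
  Incomparable x y = ¬ (x ≼ y) × ¬ (y ≼ x)

open PartialOrderOn public using (_≼_)

module _ {n : ℕ} (P : PartialOrderOn n) where
  open PartialOrderOn P using () renaming (_≼_ to _≼ₚ_; _≺_ to _≺ₚ_; Incomparable to Inc; _≼?_ to _≼?ₚ_)

  NaturallyLabelled : Set
  NaturallyLabelled = ∀ x y → x ≺ₚ y → x < y

  ThreeFree : Set
  ThreeFree = ¬ (∃[ x ] ∃[ y ] ∃[ z ] (x ≺ₚ y × y ≺ₚ z))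

  TwoPlusTwoFree : Set
  TwoPlusTwoFree = ¬ (∃[ i ] ∃[ j ] ∃[ k ] ∃[ l ]
    (i ≺ₚ j × k ≺ₚ l
     × Inc i k × Inc i l
     × Inc j k × Inc j l))

  incidence : Fin n → Fin n → Bool
  incidence i j = does (i ≼?ₚ j)

Good : {n : ℕ} → PartialOrderOn n → Set
Good P = NaturallyLabelled P × ThreeFree P × TwoPlusTwoFree P

Matrix : ℕ → Set
Matrix n = Fin n → Fin n → Bool

module _ {n : ℕ} (M : Matrix n) where

  UpperTriangular : Set
  UpperTriangular = ∀ i j → i > j → M i j ≡ false

  DiagonalOnes : Set
  DiagonalOnes = ∀ i → M i i ≡ true

  Avoids0 : Set
  Avoids0 = ¬ (∃[ i ] ∃[ j ] ∃[ k ] (i < j × j < k × M i j ≡ true × M j k ≡ true))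

  AvoidsPattern : Bool → Bool → Bool → Bool → Bool → Bool → Set
  AvoidsPattern ab ac ad bc bd cd = ¬ (∃[ a ] ∃[ b ] ∃[ c ] ∃[ d ]
    (a < b × b < c × c < d
     × M a b ≡ ab × M a c ≡ ac × M a d ≡ ad
     × M b c ≡ bc × M b d ≡ bd × M c d ≡ cd))

  Avoids1 : Set
  Avoids1 = AvoidsPattern true false false false false true

  Avoids2 : Set
  Avoids2 = AvoidsPattern false true false false true false

  Avoids3 : Set
  Avoids3 = AvoidsPattern false false true true false false

  Target : Set
  Target = UpperTriangular × DiagonalOnes × Avoids0 × Avoids1 × Avoids2 × Avoids3

{-# OPTIONS --safe #-}
module Submission where

-- An order is recovered from its incidence matrix, so the map is injective, and for a
-- naturally labelled order the matrix is upper unitriangular.  Read in the other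
-- direction, the relation "M i j = 1" of an upper unitriangular matrix is reflexive and
-- antisymmetric, and avoiding M₀ makes it both transitive and free of 3-chains.
-- An induced 2+2 with chains i ≺ j and k ≺ l, after swapping the chains so that i < k,
-- has its four points in one of three relative orders, i < j < k < l, i < k < j < l or
-- i < k < l < j, and the 4×4 submatrix on them is M₁, M₂ or M₃ respectively.

open import Defs
open import Data.Nat using (ℕ)
open import Data.Fin using (Fin; _<_; _≟_)
open import Data.Fin.Properties using (<-cmp; <-asym; <-trans; <⇒≢)
open import Data.Bool using (true; false)
open import Data.Bool.Properties using (¬-not) renaming (_≟_ to _≟ᵇ_)
open import Data.Product using (_×_; Σ-syntax; _,_; swap)
open import Data.Empty using (⊥-elim)
open import Function using (_∘_)
open import Function.Bundles using (_⇔_; mk⇔)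
open import Relation.Nullary using (¬_; Dec; yes; no; does)
open import Relation.Nullary.Decidable using (dec-true)
open import Relation.Binary using (tri<; tri≈; tri>; IsPartialOrder)
open import Relation.Binary.PropositionalEquality using (_≡_; _≢_; refl; sym; trans; isEquivalence)

does-true⇒ : ∀ {A : Set} (a? : Dec A) → does a? ≡ true → A
does-true⇒ (yes a) _ = a

does-false⇒ : ∀ {A : Set} (a? : Dec A) → does a? ≡ false → ¬ A
does-false⇒ (no ¬a) _ = ¬a

incidence-injective : ∀ {n} (P Q : PartialOrderOn n)
  → (∀ i j → incidence P i j ≡ incidence Q i j)
  → ∀ i j → (_≼_ P i j ⇔ _≼_ Q i j)
incidence-injective P Q P≡Q i j = mk⇔
  (λ p → does-true⇒ (i ≼Q? j) (trans (sym (P≡Q i j)) (dec-true (i ≼P? j) p)))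
  (λ q → does-true⇒ (i ≼P? j) (trans (P≡Q i j) (dec-true (i ≼Q? j) q)))
  where
  open PartialOrderOn P using () renaming (_≼?_ to _≼P?_)
  open PartialOrderOn Q using () renaming (_≼?_ to _≼Q?_)

module IncidenceOfNaturallyLabelled {n : ℕ} (P : PartialOrderOn n) (labelled : NaturallyLabelled P) where
  open PartialOrderOn P renaming (_≼_ to _≼ₚ_)
  open IsPartialOrder isPartialOrder using () renaming (refl to ≼-refl)

  private
    M = incidence P

    one⇒≺ : ∀ {x y} → x < y → M x y ≡ true → x ≺ y
    one⇒≺ {x} {y} x<y Mxy = does-true⇒ (x ≼? y) Mxy , <⇒≢ x<y

  ≼⇒≮ : ∀ {x y} → x ≼ₚ y → ¬ (y < x)
  ≼⇒≮ x≼y y<x = <-asym y<x (labelled _ _ (x≼y , <⇒≢ y<x ∘ sym))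

  zero⇒incomparable : ∀ {x y} → x < y → M x y ≡ false → Incomparable x y
  zero⇒incomparable {x} {y} x<y Mxy = does-false⇒ (x ≼? y) Mxy , λ y≼x → ≼⇒≮ y≼x x<y

  zero⇒incomparableᵀ : ∀ {x y} → x < y → M x y ≡ false → Incomparable y x
  zero⇒incomparableᵀ x<y = swap ∘ zero⇒incomparable x<y

  upperTriangular : UpperTriangular M
  upperTriangular i j j<i with i ≼? j
  ... | yes i≼j = ⊥-elim (≼⇒≮ i≼j j<i)
  ... | no _ = refl

  diagonalOnes : DiagonalOnes M
  diagonalOnes i = dec-true (i ≼? i) ≼-refl

  avoids0 : ThreeFree P → Avoids0 M
  avoids0 no3 (i , j , k , i<j , j<k , Mij , Mjk) = no3 (i , j , k , one⇒≺ i<j Mij , one⇒≺ j<k Mjk)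

  module _ (no2+2 : TwoPlusTwoFree P) where

    avoids1 : Avoids1 M
    avoids1 (a , b , c , d , a<b , b<c , c<d , Mab , Mac , Mad , Mbc , Mbd , Mcd) =
      no2+2 (a , b , c , d , one⇒≺ a<b Mab , one⇒≺ c<d Mcd ,
             zero⇒incomparable a<c Mac , zero⇒incomparable (<-trans a<c c<d) Mad ,
             zero⇒incomparable b<c Mbc , zero⇒incomparable b<d Mbd)
      where
      a<c = <-trans a<b b<c
      b<d = <-trans b<c c<d

    avoids2 : Avoids2 M
    avoids2 (a , b , c , d , a<b , b<c , c<d , Mab , Mac , Mad , Mbc , Mbd , Mcd) =
      no2+2 (a , c , b , d , one⇒≺ a<c Mac , one⇒≺ b<d Mbd ,
             zero⇒incomparable a<b Mab , zero⇒incomparable (<-trans a<b b<d) Mad ,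
             zero⇒incomparableᵀ b<c Mbc , zero⇒incomparable c<d Mcd)
      where
      a<c = <-trans a<b b<c
      b<d = <-trans b<c c<d

    avoids3 : Avoids3 M
    avoids3 (a , b , c , d , a<b , b<c , c<d , Mab , Mac , Mad , Mbc , Mbd , Mcd) =
      no2+2 (a , d , b , c , one⇒≺ (<-trans a<b b<d) Mad , one⇒≺ b<c Mbc ,
             zero⇒incomparable a<b Mab , zero⇒incomparable (<-trans a<b b<c) Mac ,
             zero⇒incomparableᵀ b<d Mbd , zero⇒incomparableᵀ c<d Mcd)
      where
      b<d = <-trans b<c c<d

incidence-target : ∀ {n} (P : PartialOrderOn n) → Good P → Target (incidence P)
incidence-target P (labelled , no3 , no2+2) =
  upperTriangular , diagonalOnes , avoids0 no3 , avoids1 no2+2 , avoids2 no2+2 , avoids3 no2+2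
  where open IncidenceOfNaturallyLabelled P labelled

module OrderOfMatrix {n : ℕ} (M : Matrix n)
  (ut : UpperTriangular M) (diag : DiagonalOnes M) (av0 : Avoids0 M) where

  _⊑_ : Fin n → Fin n → Set
  i ⊑ j = M i j ≡ true

  ⊑∧≢⇒< : ∀ {i j} → i ⊑ j → i ≢ j → i < j
  ⊑∧≢⇒< {i} {j} i⊑j i≢j with <-cmp i j
  ... | tri< i<j _ _ = i<j
  ... | tri≈ _ i≡j _ = ⊥-elim (i≢j i≡j)
  ... | tri> _ _ j<i with trans (sym i⊑j) (ut i j j<i)
  ... | ()

  ⊑-reflexive : ∀ {i j} → i ≡ j → i ⊑ j
  ⊑-reflexive {i} refl = diag i

  ⊑-trans : ∀ {i j k} → i ⊑ j → j ⊑ k → i ⊑ k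
  ⊑-trans {i} {j} {k} i⊑j j⊑k with i ≟ j | j ≟ k
  ... | yes refl | _ = j⊑k
  ... | no _ | yes refl = i⊑j
  ... | no i≢j | no j≢k = ⊥-elim (av0 (i , j , k , ⊑∧≢⇒< i⊑j i≢j , ⊑∧≢⇒< j⊑k j≢k , i⊑j , j⊑k))

  ⊑-antisym : ∀ {i j} → i ⊑ j → j ⊑ i → i ≡ j
  ⊑-antisym {i} {j} i⊑j j⊑i with i ≟ j
  ... | yes i≡j = i≡j
  ... | no i≢j = ⊥-elim (<-asym (⊑∧≢⇒< i⊑j i≢j) (⊑∧≢⇒< j⊑i (i≢j ∘ sym)))

  order : PartialOrderOn n
  order = record
    { _≼_ = _⊑_
    ; _≼?_ = λ i j → M i j ≟ᵇ true
    ; isPartialOrder = record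
      { isPreorder = record { isEquivalence = isEquivalence ; reflexive = ⊑-reflexive ; trans = ⊑-trans }
      ; antisym = ⊑-antisym
      }
    }

  open PartialOrderOn order using (_≺_; Incomparable)

  incidence-order : ∀ i j → incidence order i j ≡ M i j
  incidence-order i j with M i j
  ... | true = refl
  ... | false = refl

  naturallyLabelled : NaturallyLabelled order
  naturallyLabelled _ _ (i⊑j , i≢j) = ⊑∧≢⇒< i⊑j i≢j

  threeFree : ThreeFree order
  threeFree (i , j , k , (i⊑j , i≢j) , (j⊑k , j≢k)) =
    av0 (i , j , k , ⊑∧≢⇒< i⊑j i≢j , ⊑∧≢⇒< j⊑k j≢k , i⊑j , j⊑k)

  TwoPlusTwo : Fin n → Fin n → Fin n → Fin n → Set
  TwoPlusTwo i j k l = i ≺ j × k ≺ l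
    × Incomparable i k × Incomparable i l × Incomparable j k × Incomparable j l

  swap-chains : ∀ {i j k l} → TwoPlusTwo i j k l → TwoPlusTwo k l i j
  swap-chains (i≺j , k≺l , ik , il , jk , jl) = k≺l , i≺j , swap ik , swap jk , swap il , swap jl

  incomparable⇒zero : ∀ {x y} → Incomparable x y → M x y ≡ false
  incomparable⇒zero (x⋢y , _) = ¬-not x⋢y

  incomparable⇒≢ : ∀ {x y} → Incomparable x y → x ≢ y
  incomparable⇒≢ (x⋢y , _) x≡y = x⋢y (⊑-reflexive x≡y)

  module _ (av1 : Avoids1 M) (av2 : Avoids2 M) (av3 : Avoids3 M) where

    no-twoPlusTwo-with-i<k : ∀ {i j k l} → i < k → ¬ TwoPlusTwo i j k l
    no-twoPlusTwo-with-i<k {i} {j} {k} {l} i<k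
      ((i⊑j , i≢j) , (k⊑l , k≢l) , ik , il , jk , jl) with <-cmp j k | <-cmp j l
    ... | tri< j<k _ _ | _ =
      av1 (i , j , k , l , ⊑∧≢⇒< i⊑j i≢j , j<k , ⊑∧≢⇒< k⊑l k≢l ,
           i⊑j , incomparable⇒zero ik , incomparable⇒zero il ,
           incomparable⇒zero jk , incomparable⇒zero jl , k⊑l)
    ... | tri≈ _ j≡k _ | _ = incomparable⇒≢ jk j≡k
    ... | tri> _ _ k<j | tri< j<l _ _ =
      av2 (i , k , j , l , i<k , k<j , j<l ,
           incomparable⇒zero ik , i⊑j , incomparable⇒zero il ,
           incomparable⇒zero (swap jk) , k⊑l , incomparable⇒zero jl)
    ... | tri> _ _ _ | tri≈ _ j≡l _ = incomparable⇒≢ jl j≡l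
    ... | tri> _ _ _ | tri> _ _ l<j =
      av3 (i , k , l , j , i<k , ⊑∧≢⇒< k⊑l k≢l , l<j ,
           incomparable⇒zero ik , incomparable⇒zero il , i⊑j ,
           k⊑l , incomparable⇒zero (swap jk) , incomparable⇒zero (swap jl))

    twoPlusTwoFree : TwoPlusTwoFree order
    twoPlusTwoFree (i , j , k , l , 2+2@(_ , _ , ik , _)) with <-cmp i k
    ... | tri< i<k _ _ = no-twoPlusTwo-with-i<k i<k 2+2
    ... | tri≈ _ i≡k _ = incomparable⇒≢ ik i≡k
    ... | tri> _ _ k<i = no-twoPlusTwo-with-i<k k<i (swap-chains 2+2)

incidence-surjective : ∀ {n} (M : Matrix n) → Target M
  → Σ[ P ∈ PartialOrderOn n ] (Good P × (∀ i j → incidence P i j ≡ M i j))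
incidence-surjective M (ut , diag , av0 , av1 , av2 , av3) =
  order , (naturallyLabelled , threeFree , twoPlusTwoFree av1 av2 av3) , incidence-order
  where open OrderOfMatrix M ut diag av0

proposition3p1 : (n : ℕ)
    -- the map lands in the target set
    → ((P : PartialOrderOn n) → Good P → Target (incidence P))
    -- injective on Good posets (posets equal = same relation)
    × ((P Q : PartialOrderOn n) → Good P → Good Q
        → (∀ i j → incidence P i j ≡ incidence Q i j)
        → ∀ i j → (_≼_ P i j ⇔ _≼_ Q i j))
    -- surjective onto the target set
    × ((M : Matrix n) → Target M
        → Σ[ P ∈ PartialOrderOn n ] (Good P × (∀ i j → incidence P i j ≡ M i j)))
proposition3p1 n =
  incidence-target , (λ P Q _ _ → incidence-injective P Q) , incidence-surjective
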